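{- For every $d$-degenerated graph $G$, $\chi_i(G)\le{\rm ch}_i(G)\le\Delta(G)+2d-1$.
   Context: All graphs are finite, simple and undirected; $\Delta(G)$ is the maximum degree. A graph $G$ is $d$-degenerated if every subgraph of $G$ contains a vertex of degree at most $d$. An incidence of $G$ is a pair $(v,e)$ with $v$ a vertex and $e$ an edge incident with $v$, written $(v,vu)$ when $e=vu$. Two incidences $(v,e)$, $(w,f)$ are adjacent if $v=w$, or $e=f$, or the edge $vw$ equals $e$ or $f$. An incidence $p$-colouring is a map from the incidences to $\{1,\dots,p\}$ giving adjacent incidences distinct colours; $\chi_i(G)$ is the least such $p$. For a list assignment $L$ (a finite set $L(v,e)$ of colours for each incidence), $G$ is $L$-list incidence colourable if there is a map $\sigma$ with $\sigma(v,e)\in L(v,e)$ and adjacent incidences receiving distinct colours. ${\rm ch}_i(G)$ is the least $k$ such that $G$ is $L$-list incidence colourable for every $L$ with all lists of size $k$. -}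

module Defs where

open import Data.Nat using (ℕ; zero; suc; _+_; _*_; _∸_; _≤_; _<_; _⊔_)
open import Data.Bool using (Bool; true; false; T; if_then_else_; _∧_)
open import Data.Fin using (Fin)
open import Data.List using (List; map; foldr; length)
open import Data.Nat.ListAction using (sum)
open import Data.List.Base using (allFin)
open import Data.List.Membership.Propositional using (_∈_)
open import Data.List.Relation.Unary.Unique.Propositional using (Unique)
open import Data.Product using (Σ; ∃; _×_; _,_)
open import Data.Sum using (_⊎_)
open import Relation.Binary.PropositionalEquality using (_≡_; _≢_)
open import Relation.Nullary using (¬_)

record Graph : Set where
  field
    n      : ℕ
    adj    : Fin n → Fin n → Bool
    sym    : ∀ u v → adj u v ≡ adj v u
    irrefl : ∀ v → adj v v ≡ false

open Graph public

boolToℕ : Bool → ℕ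
boolToℕ true  = 1
boolToℕ false = 0

degree : (G : Graph) → Fin (n G) → ℕ
degree G v = sum (map (λ u → boolToℕ (adj G v u)) (allFin (n G)))

maxDegree : Graph → ℕ
maxDegree G = foldr _⊔_ 0 (map (degree G) (allFin (n G)))

record Subgraph (G : Graph) : Set where
  field
    S        : Fin (n G) → Bool
    E        : Fin (n G) → Fin (n G) → Bool
    E-sym    : ∀ u v → E u v ≡ E v u
    E⊆adj    : ∀ u v → T (E u v) → T (adj G u v)
    E⊆S      : ∀ u v → T (E u v) → T (S u ∧ S v)
    nonempty : ∃ λ v → T (S v)

open Subgraph public

subDegree : {G : Graph} → Subgraph G → Fin (n G) → ℕ
subDegree {G} H v = sum (map (λ u → boolToℕ (E H v u)) (allFin (n G)))

Degenerated : ℕ → Graph → Set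
Degenerated d G = (H : Subgraph G) → ∃ λ v → T (S H v) × subDegree H v ≤ d

record Incidence (G : Graph) : Set where
  constructor inc
  field
    vtx   : Fin (n G)
    other : Fin (n G)
    isEdge : T (adj G vtx other)

open Incidence public

SameEdge : {m : ℕ} → Fin m → Fin m → Fin m → Fin m → Set
SameEdge a b c d = (a ≡ c × b ≡ d) ⊎ (a ≡ d × b ≡ c)

-- Adjacency of incidences (v,vu) and (w,wx):
-- v = w, or e = f, or the edge vw equals e or f.
IncAdj : (G : Graph) → Incidence G → Incidence G → Set
IncAdj G (inc v u _) (inc w x _) =
  v ≡ w
  ⊎ SameEdge v u w x
  ⊎ (T (adj G v w) × (SameEdge v w v u ⊎ SameEdge v w w x))

IncColourable : Graph → ℕ → Set
IncColourable G p =
  Σ (Incidence G → Fin p) λ σ →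
    ∀ i j → i ≢ j → IncAdj G i j → σ i ≢ σ j

ListIncColourable : (G : Graph) → (Incidence G → List ℕ) → Set
ListIncColourable G L =
  Σ (Incidence G → ℕ) λ σ →
    (∀ i → σ i ∈ L i) × (∀ i j → i ≢ j → IncAdj G i j → σ i ≢ σ j)

-- L is a list assignment with all lists of size k (lists are sets: no repetitions)
ListAssignmentOfSize : (G : Graph) → ℕ → (Incidence G → List ℕ) → Set
ListAssignmentOfSize G k L = ∀ i → Unique (L i) × length (L i) ≡ k

IncChoosable : Graph → ℕ → Set
IncChoosable G k = ∀ L → ListAssignmentOfSize G k L → ListIncColourable G L

IsIncChromatic : Graph → ℕ → Set
IsIncChromatic G k = IncColourable G k × (∀ p → p < k → ¬ IncColourable G p)

IsIncChoice : Graph → ℕ → Set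
IsIncChoice G k = IncChoosable G k × (∀ p → p < k → ¬ IncChoosable G p)

-- Removing vertices of degree at most d one by one ranks the vertices so that each has at
-- most d neighbours of smaller rank. Order the incidences (a, ab) lexicographically by the
-- smaller rank of a and b, then the incidence at the lower end first, then by the larger
-- rank. Every incidence adjacent to (a, ab) sits at a, sits at b, or is of the form (c, ca);
-- counting those that precede (a, ab) in this order leaves at most Δ + 2d - 2 of them, so
-- colouring greedily along the order succeeds from any lists of size Δ + 2d - 1.
-- Choosability is decidable because the colours of a list assignment may be relabelled into
-- a fixed finite range, so the least admissible sizes exist; and χᵢ ≤ chᵢ since colouring
-- from the lists {0, …, k - 1} is a k-colouring.

module Submission where

open import Defs hiding (sym)
open import Data.Bool using (Bool; true; false; T; _∧_; if_then_else_)
open import Data.Bool.Properties using (T-irrelevant; T-∧; ∧-comm)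
open import Data.Empty using (⊥-elim)
open import Data.Fin using (Fin; zero; suc; toℕ; fromℕ<)
open import Data.Fin.Properties using (toℕ<n; toℕ-injective; toℕ-fromℕ<) renaming (_≟_ to _≟ᶠ_)
open import Data.List using (List; []; _∷_; [_]; _++_; length; map; filter; concatMap; foldr; upTo; allFin; lookup)
open import Data.List.Properties using (length-map; length-++; length-filter; filter-notAll; filter-some; length-upTo; length-tabulate)
open import Data.List.Membership.Propositional using (_∈_; _∉_; find; lose; mapWith∈)
open import Data.List.Membership.Setoid.Properties using (length-mapWith∈)
open import Data.List.Membership.Propositional.Properties
  using (∈-map⁺; ∈-map⁻; ∈-filter⁺; ∈-filter⁻; ∈-concatMap⁺; ∈-concatMap⁻; ∈-++⁺ˡ; ∈-++⁺ʳ; ∈-allFin; ∈-upTo⁺; ∈-upTo⁻)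
open import Data.List.Relation.Unary.Any as Any using (Any; here; there; any?)
open import Data.List.Relation.Unary.All as All using (All; all?)
import Data.List.Relation.Unary.All.Properties as All
open import Data.List.Relation.Unary.Any.Properties using (lookup-index; mapWith∈⁺)
open import Data.List.Relation.Unary.AllPairs using ([]; _∷_)
open import Data.List.Relation.Unary.Unique.Propositional using (Unique)
open import Data.List.Relation.Unary.Unique.Propositional.Properties using (upTo⁺)
import Data.List.Relation.Binary.Sublist.Propositional as Sublist
import Data.List.Relation.Binary.Sublist.Propositional.Properties as Sublist
open import Data.Nat using (ℕ; zero; suc; _+_; _*_; _∸_; _≤_; _<_; _⊔_; z≤n; s≤s; _<?_; _<ᵇ_; z<s; s<s)
open import Data.Nat.Properties
open import Data.Nat.ListAction using (sum)
open import Data.Product using (Σ; ∃; _×_; _,_; proj₁; proj₂)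
open import Data.Sum using (_⊎_; inj₁; inj₂; [_,_]′)
open import Data.Vec as Vec using (Vec; []; _∷_)
open import Data.Vec.Properties using (lookup∘tabulate; toList∘fromList)
open import Data.Vec.Membership.Propositional.Properties using (∈-lookup; ∈-fromList⁻)
open import Function using (id; _∘_; _⇔_; mk⇔; Equivalence)
open import Relation.Binary using (DecidableEquality; Symmetric; tri<; tri≈; tri>)
open import Relation.Binary.PropositionalEquality using (_≡_; _≢_; refl; sym; trans; cong; cong₂; subst; subst₂; module ≡-Reasoning; setoid)
open import Relation.Nullary using (¬_; Dec; yes; no; does; contradiction; ofʸ; ofⁿ)
open import Relation.Nullary.Decidable using (map′; ¬?; _×-dec_; _⊎-dec_; _→-dec_; T?; decidable-stable)
open import Relation.Unary using (Decidable; _⊆_)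

module _ {A : Set} where

  sum-boolToℕ : (f : A → Bool) (xs : List A) →
                sum (map (boolToℕ ∘ f) xs) ≡ length (filter (T? ∘ f) xs)
  sum-boolToℕ f [] = refl
  sum-boolToℕ f (x ∷ xs) with f x
  ... | true  = cong suc (sum-boolToℕ f xs)
  ... | false = sum-boolToℕ f xs

  module _ {P Q : A → Set} (P? : Decidable P) (Q? : Decidable Q) (P⊆Q : P ⊆ Q) where

    length-filter-mono : ∀ xs → length (filter P? xs) ≤ length (filter Q? xs)
    length-filter-mono xs =
      Sublist.length-mono-≤ (Sublist.filter⁺ P? Q? (λ { refl → P⊆Q }) (Sublist.⊆-refl {x = xs}))

    length-filter-< : ∀ {x xs} → x ∈ xs → Q x → ¬ P x →
                      length (filter P? xs) < length (filter Q? xs)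
    length-filter-< {xs = y ∷ ys} (here refl) Qx ¬Px with P? y | Q? y
    ... | yes Px | _      = contradiction Px ¬Px
    ... | no _   | yes _  = s≤s (length-filter-mono ys)
    ... | no _   | no ¬Qx = contradiction Qx ¬Qx
    length-filter-< {xs = y ∷ ys} (there x∈ys) Qx ¬Px with P? y | Q? y
    ... | yes Py | no ¬Qy = contradiction (P⊆Q Py) ¬Qy
    ... | yes _  | yes _  = s≤s (length-filter-< x∈ys Qx ¬Px)
    ... | no _   | yes _  = m<n⇒m<1+n (length-filter-< x∈ys Qx ¬Px)
    ... | no _   | no _   = length-filter-< x∈ys Qx ¬Px

  length-concatMap-const : ∀ {B : Set} {k} (f : A → List B) → (∀ x → length (f x) ≡ k) →
                           ∀ xs → length (concatMap f xs) ≡ length xs * k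
  length-concatMap-const f |f|≡k []       = refl
  length-concatMap-const f |f|≡k (x ∷ xs) =
    trans (length-++ (f x)) (cong₂ _+_ (|f|≡k x) (length-concatMap-const f |f|≡k xs))

  Unique-map⁺ : ∀ {B : Set} {f : A → B} {xs} →
                (∀ {x y} → x ∈ xs → y ∈ xs → f x ≡ f y → x ≡ y) →
                Unique xs → Unique (map f xs)
  Unique-map⁺ {xs = []}    _   []            = []
  Unique-map⁺ {xs = x ∷ _} inj (x≢xs ∷ xs!) =
    All.map⁺ (All.tabulate λ y∈xs fx≡fy → All.lookup x≢xs y∈xs (inj (here refl) (there y∈xs) fx≡fy))
    ∷ Unique-map⁺ (λ x∈ y∈ → inj (there x∈) (there y∈)) xs!

  module _ (_≟_ : DecidableEquality A) where

    open import Data.List.Membership.DecPropositional _≟_ using (_∈?_)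

    length-≤-⊆ : ∀ {xs ys : List A} → Unique xs → (∀ {z} → z ∈ xs → z ∈ ys) → length xs ≤ length ys
    length-≤-⊆ [] _ = z≤n
    length-≤-⊆ {x ∷ xs} {ys} (x≢xs ∷ xs!) xs⊆ys = begin-strict
      length xs                        ≤⟨ length-≤-⊆ xs! xs⊆others ⟩
      length (filter (¬? ∘ (x ≟_)) ys) <⟨ filter-notAll (¬? ∘ (x ≟_)) ys (Any.map (λ x≡y x≢y → x≢y x≡y) (xs⊆ys (here refl))) ⟩
      length ys                        ∎
      where
      open ≤-Reasoning
      xs⊆others : ∀ {z} → z ∈ xs → z ∈ filter (¬? ∘ (x ≟_)) ys
      xs⊆others z∈xs = ∈-filter⁺ (¬? ∘ (x ≟_)) (xs⊆ys (there z∈xs)) (All.lookup x≢xs z∈xs)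

    ∃-∉ : ∀ {xs ys : List A} → Unique xs → length ys < length xs → ∃ λ x → x ∈ xs × x ∉ ys
    ∃-∉ {xs} {ys} xs! ys<xs with any? (λ x → ¬? (x ∈? ys)) xs
    ... | yes some = find some
    ... | no none  = contradiction (length-≤-⊆ xs! (λ z∈xs → decidable-stable (_ ∈? ys) (none ∘ lose z∈xs))) (<⇒≱ ys<xs)

≤-foldr-⊔ : ∀ {m ns} → m ∈ ns → m ≤ foldr _⊔_ 0 ns
≤-foldr-⊔ {ns = k ∷ _} (here refl) = m≤m⊔n k _
≤-foldr-⊔ {ns = k ∷ _} (there m∈)  = ≤-trans (≤-foldr-⊔ m∈) (m≤n⊔m k _)

module _ {P : ℕ → Set} (P? : Decidable P) where

  private
    firstBelow : ∀ m → (∀ j → j < m → ¬ P j) ⊎ Σ ℕ (λ k → P k × (∀ j → j < k → ¬ P j))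
    firstBelow zero = inj₁ (λ _ ())
    firstBelow (suc m) with firstBelow m
    ... | inj₂ least = inj₂ least
    ... | inj₁ none with P? m
    ...   | yes Pm  = inj₂ (m , Pm , none)
    ...   | no  ¬Pm = inj₁ λ j j<1+m → [ none j , (λ { refl → ¬Pm }) ]′ (m<1+n⇒m<n∨m≡n j<1+m)

  minimal : ∀ {m} → P m → Σ ℕ λ k → P k × (∀ j → j < k → ¬ P j)
  minimal {m} Pm with firstBelow (suc m)
  ... | inj₁ none  = contradiction Pm (none m ≤-refl)
  ... | inj₂ least = least

module _ {A : Set} where

  vectorsOver : ∀ {N} → (Fin N → List A) → List (Vec A N)
  vectorsOver {zero}  g = [ [] ]
  vectorsOver {suc N} g = concatMap (λ x → map (x ∷_) (vectorsOver (g ∘ suc))) (g zero)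

  ∈-vectorsOver⁺ : ∀ {N} {g : Fin N → List A} (v : Vec A N) →
                   (∀ k → Vec.lookup v k ∈ g k) → v ∈ vectorsOver g
  ∈-vectorsOver⁺ []      _   = here refl
  ∈-vectorsOver⁺ (x ∷ v) v∈g =
    ∈-concatMap⁺ _ (lose (v∈g zero) (∈-map⁺ (x ∷_) (∈-vectorsOver⁺ v (v∈g ∘ suc))))

  ∈-vectorsOver⁻ : ∀ {N} {g : Fin N → List A} {v : Vec A N} →
                   v ∈ vectorsOver g → ∀ k → Vec.lookup v k ∈ g k
  ∈-vectorsOver⁻ {suc N} {g} v∈ k with find (∈-concatMap⁻ _ {xs = g zero} v∈)
  ... | x , x∈g₀ , v∈ₓ with ∈-map⁻ (x ∷_) v∈ₓ
  ... | w , w∈ , refl with k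
  ... | zero  = x∈g₀
  ... | suc k = ∈-vectorsOver⁻ w∈ k

  listsOfLength : ℕ → List A → List (List A)
  listsOfLength p U = map Vec.toList (vectorsOver {p} (λ _ → U))

  ∈-listsOfLength : ∀ {U} (xs : List A) → (∀ {x} → x ∈ xs → x ∈ U) → xs ∈ listsOfLength (length xs) U
  ∈-listsOfLength {U} xs xs⊆U = subst (_∈ listsOfLength (length xs) U) (toList∘fromList xs)
    (∈-map⁺ Vec.toList (∈-vectorsOver⁺ (Vec.fromList xs) (λ k → xs⊆U (∈-fromList⁻ (∈-lookup k (Vec.fromList xs))))))

module Relabelling {A : Set} (_≟_ : DecidableEquality A) (U : List A) where

  open import Data.List.Membership.DecPropositional _≟_ using (_∈?_)

  position : A → ℕ
  position x with x ∈? U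
  ... | yes x∈U = toℕ (Any.index x∈U)
  ... | no  _   = 0

  position< : ∀ {x} → x ∈ U → position x < length U
  position< {x} x∈U with x ∈? U
  ... | yes x∈U′ = toℕ<n (Any.index x∈U′)
  ... | no  x∉U  = contradiction x∈U x∉U

  position-injective : ∀ {x y} → x ∈ U → y ∈ U → position x ≡ position y → x ≡ y
  position-injective {x} {y} x∈U y∈U eq with x ∈? U | y ∈? U
  ... | no x∉U  | _       = contradiction x∈U x∉U
  ... | yes _   | no y∉U  = contradiction y∈U y∉U
  ... | yes x∈U′ | yes y∈U′ = begin
    x                             ≡⟨ lookup-index x∈U′ ⟩
    lookup U (Any.index x∈U′)     ≡⟨ cong (lookup U) (toℕ-injective eq) ⟩
    lookup U (Any.index y∈U′)     ≡⟨ sym (lookup-index y∈U′) ⟩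
    y                             ∎
    where open ≡-Reasoning

pair : ℕ → ℕ → ℕ → ℕ
pair N c s = c * N + s

pair-mono-< : ∀ {N c c′ s s′} → s < N → c < c′ → pair N c s < pair N c′ s′
pair-mono-< {N} {c} {c′} {s} {s′} s<N c<c′ = begin-strict
  c * N + s   <⟨ +-monoʳ-< (c * N) s<N ⟩
  c * N + N   ≡⟨ +-comm (c * N) N ⟩
  suc c * N   ≤⟨ *-monoˡ-≤ N c<c′ ⟩
  c′ * N      ≤⟨ m≤m+n (c′ * N) s′ ⟩
  c′ * N + s′ ∎
  where open ≤-Reasoning

pair-≤⇒lex : ∀ {N c c′ s s′} → s′ < N → pair N c s ≤ pair N c′ s′ → c < c′ ⊎ (c ≡ c′ × s ≤ s′)
pair-≤⇒lex {N} {c} {c′} {s} {s′} s′<N le with <-cmp c c′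
... | tri< c<c′ _ _ = inj₁ c<c′
... | tri≈ _ refl _ = inj₂ (refl , +-cancelˡ-≤ (c * N) s s′ le)
... | tri> _ _ c′<c = contradiction le (<⇒≱ (pair-mono-< s′<N c′<c))

pair-injective : ∀ {N c c′ s s′} → s < N → s′ < N → pair N c s ≡ pair N c′ s′ → c ≡ c′ × s ≡ s′
pair-injective {N} {c} {c′} {s} {s′} s<N s′<N eq
  with pair-≤⇒lex {N} {c} {c′} s′<N (≤-reflexive eq) | pair-≤⇒lex {N} {c′} {c} s<N (≤-reflexive (sym eq))
... | inj₁ c<c′          | inj₁ c′<c         = contradiction c<c′ (<-asym c′<c)
... | inj₁ c<c′          | inj₂ (refl , _)   = contradiction c<c′ (<-irrefl refl)
... | inj₂ (refl , _)    | inj₁ c′<c         = contradiction c′<c (<-irrefl refl)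
... | inj₂ (refl , s≤s′) | inj₂ (_ , s′≤s)   = refl , ≤-antisym s≤s′ s′≤s

-- Greedy list colouring

module GreedyListColouring
  {A : Set} (Conflict : A → A → Set) (conflict-sym : Symmetric Conflict)
  (key : A → ℕ) (key-injective : ∀ {x y} → key x ≡ key y → x ≡ y)
  (B : ℕ) (key<B : ∀ x → key x < B) (K : ℕ)
  where

  record EarlierCover (x : A) : Set where
    field
      members  : List A
      length≤K : length members ≤ K
      self     : x ∈ members
      earlier  : ∀ y → key y < key x → Conflict x y → y ∈ members

  module _ (cover : ∀ x → EarlierCover x)
           (L : A → List ℕ) (L-unique : ∀ x → Unique (L x)) (L-length : ∀ x → length (L x) ≡ K)
           where

    open EarlierCover

    record ColouredBelow (m : ℕ) : Set where
      field
        colour   : A → ℕ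
        fromList : ∀ x → key x < m → colour x ∈ L x
        proper   : ∀ x y → key y < key x → key x < m → Conflict x y → colour x ≢ colour y

    open ColouredBelow

    extend : ∀ {m} → ColouredBelow m → ColouredBelow (suc m)
    extend {m} c = record { colour = colour′ ; fromList = fromList′ ; proper = proper′ }
      where
      earlierColours : A → List ℕ
      earlierColours x = map (colour c) (filter (λ y → key y <? m) (members (cover x)))

      fresh : ∀ x → key x ≡ m → ∃ λ col → col ∈ L x × col ∉ earlierColours x
      fresh x refl = ∃-∉ _≟_ (L-unique x) (begin-strict
        length (earlierColours x)                                  ≡⟨ length-map (colour c) (filter (λ y → key y <? m) (members (cover x))) ⟩
        length (filter (λ y → key y <? m) (members (cover x)))     <⟨ filter-notAll _ _ (lose (self (cover x)) (<-irrefl refl)) ⟩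
        length (members (cover x))                                 ≤⟨ length≤K (cover x) ⟩
        K                                                          ≡⟨ sym (L-length x) ⟩
        length (L x)                                               ∎)
        where open ≤-Reasoning

      colour′ : A → ℕ
      colour′ x with key x ≟ m
      ... | yes k≡m = proj₁ (fresh x k≡m)
      ... | no  _   = colour c x

      colour′-old : ∀ {y} → key y < m → colour′ y ≡ colour c y
      colour′-old {y} k<m with key y ≟ m
      ... | yes k≡m = contradiction k≡m (<⇒≢ k<m)
      ... | no  _   = refl

      fromList′ : ∀ x → key x < suc m → colour′ x ∈ L x
      fromList′ x k<1+m with key x ≟ m
      ... | yes k≡m = proj₁ (proj₂ (fresh x k≡m))
      ... | no  k≢m = fromList c x (≤∧≢⇒< (≤-pred k<1+m) k≢m)

      proper′ : ∀ x y → key y < key x → key x < suc m → Conflict x y → colour′ x ≢ colour′ y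
      proper′ x y ky<kx kx<1+m xy rewrite colour′-old {y} (<-≤-trans ky<kx (≤-pred kx<1+m)) with key x ≟ m
      ... | yes refl = λ eq → proj₂ (proj₂ (fresh x refl))
                         (subst (_∈ earlierColours x) (sym eq)
                           (∈-map⁺ (colour c) (∈-filter⁺ _ (earlier (cover x) y ky<kx xy) ky<kx)))
      ... | no  k≢m  = proper c x y ky<kx (≤∧≢⇒< (≤-pred kx<1+m) k≢m) xy

    colouredBelow : ∀ m → ColouredBelow m
    colouredBelow zero    = record { colour = λ _ → 0 ; fromList = λ _ () ; proper = λ _ _ _ () }
    colouredBelow (suc m) = extend (colouredBelow m)

    listColouring : Σ (A → ℕ) λ σ → (∀ x → σ x ∈ L x) × (∀ x y → x ≢ y → Conflict x y → σ x ≢ σ y)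
    listColouring = colour c , (λ x → fromList c x (key<B x)) , distinct
      where
      c : ColouredBelow B
      c = colouredBelow B
      distinct : ∀ x y → x ≢ y → Conflict x y → colour c x ≢ colour c y
      distinct x y x≢y xy with <-cmp (key x) (key y)
      ... | tri< kx<ky _ _ = proper c y x kx<ky (key<B y) (conflict-sym xy) ∘ sym
      ... | tri≈ _ kx≡ky _ = contradiction (key-injective kx≡ky) x≢y
      ... | tri> _ _ ky<kx = proper c x y ky<kx (key<B x) xy

-- Degeneracy orderings

Vertex : Graph → Set
Vertex G = Fin (n G)

vertices : (G : Graph) → List (Vertex G)
vertices G = allFin (n G)

earlierNeighbours : (G : Graph) → (Vertex G → ℕ) → Vertex G → List (Vertex G)
earlierNeighbours G rank v = filter (λ w → T? (adj G v w) ×-dec rank w <? rank v) (vertices G)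

record DegeneracyOrdering (d : ℕ) (G : Graph) : Set where
  field
    rank           : Vertex G → ℕ
    rank<n         : ∀ v → rank v < n G
    rank-injective : ∀ {u v} → rank u ≡ rank v → u ≡ v
    few-earlier    : ∀ v → length (earlierNeighbours G rank v) ≤ d

module _ {d : ℕ} {G : Graph} (degenerate : Degenerated d G) where

  private
    V = Vertex G

    size : (V → Bool) → ℕ
    size X = length (filter (T? ∘ X) (vertices G))

    earlierIn : (V → Bool) → (V → ℕ) → V → List V
    earlierIn X rank v = filter (λ w → T? (adj G v w) ×-dec T? (X w) ×-dec rank w <? rank v) (vertices G)

    induced : (X : V → Bool) → ∃ (T ∘ X) → Subgraph G
    induced X (v , Xv) = record
      { S        = X
      ; E        = λ u w → (X u ∧ X w) ∧ adj G u w
      ; E-sym    = λ u w → cong₂ _∧_ (∧-comm (X u) (X w)) (Graph.sym G u w)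
      ; E⊆adj    = λ u w → proj₂ ∘ Equivalence.to T-∧
      ; E⊆S      = λ u w → proj₁ ∘ Equivalence.to T-∧
      ; nonempty = v , Xv
      }

    remove : (V → Bool) → V → V → Bool
    remove X v w = if does (w ≟ᶠ v) then false else X w

    remove⁺ : ∀ X {v w} → T (X w) → w ≢ v → T (remove X v w)
    remove⁺ X {v} {w} Xw w≢v with w ≟ᶠ v
    ... | yes w≡v = contradiction w≡v w≢v
    ... | no  _   = Xw

    remove⁻ : ∀ X {v w} → T (remove X v w) → T (X w) × w ≢ v
    remove⁻ X {v} {w} t with w ≟ᶠ v
    ... | no w≢v = t , w≢v

    remove-shrinks : ∀ X {v} → T (X v) → size (remove X v) < size X
    remove-shrinks X {v} Xv =
      length-filter-< (T? ∘ remove X v) (T? ∘ X) (proj₁ ∘ remove⁻ X) (∈-allFin v) Xv (λ t → proj₂ (remove⁻ X t) refl)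

    record Ranking (X : V → Bool) : Set where
      field
        rank           : V → ℕ
        rank<size      : ∀ {v} → T (X v) → rank v < size X
        rank-injective : ∀ {u v} → T (X u) → T (X v) → rank u ≡ rank v → u ≡ v
        few-earlier    : ∀ {v} → T (X v) → length (earlierIn X rank v) ≤ d

    emptyRanking : ∀ {X} → (∀ v → ¬ T (X v)) → Ranking X
    emptyRanking empty = record
      { rank           = λ _ → 0
      ; rank<size      = λ {v} Xv → contradiction Xv (empty v)
      ; rank-injective = λ {u} Xu → contradiction Xu (empty u)
      ; few-earlier    = λ {v} Xv → contradiction Xv (empty v)
      }

    -- v is ranked last, so its earlier neighbours are all its neighbours in X.
    rankLast : ∀ {X v} → T (X v) →
               length (filter (λ w → T? ((X v ∧ X w) ∧ adj G v w)) (vertices G)) ≤ d →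
               Ranking (remove X v) → Ranking X
    rankLast {X} {v} Xv degree≤d R = record
      { rank = rank ; rank<size = rank<size ; rank-injective = rank-injective ; few-earlier = few-earlier }
      where
      module R = Ranking R

      rank : V → ℕ
      rank w = if does (w ≟ᶠ v) then size (remove X v) else R.rank w

      rank<size : ∀ {w} → T (X w) → rank w < size X
      rank<size {w} Xw with w ≟ᶠ v
      ... | yes refl = remove-shrinks X Xv
      ... | no  w≢v  = <-trans (R.rank<size (remove⁺ X Xw w≢v)) (remove-shrinks X Xv)

      rank-injective : ∀ {u w} → T (X u) → T (X w) → rank u ≡ rank w → u ≡ w
      rank-injective {u} {w} Xu Xw ru≡rw with u ≟ᶠ v | w ≟ᶠ v
      ... | yes refl | yes refl = refl
      ... | yes refl | no  w≢v  = contradiction (sym ru≡rw) (<⇒≢ (R.rank<size (remove⁺ X Xw w≢v)))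
      ... | no  u≢v  | yes refl = contradiction ru≡rw (<⇒≢ (R.rank<size (remove⁺ X Xu u≢v)))
      ... | no  u≢v  | no  w≢v  = R.rank-injective (remove⁺ X Xu u≢v) (remove⁺ X Xw w≢v) ru≡rw

      earlier-remains : ∀ {w} → T (X w) → w ≢ v → ∀ {u} →
                        T (adj G w u) × T (X u) × rank u < R.rank w →
                        T (adj G w u) × T (remove X v u) × R.rank u < R.rank w
      earlier-remains {w} Xw w≢v {u} (wu , Xu , ru<rw) with u ≟ᶠ v
      ... | yes refl = contradiction ru<rw (<-asym (R.rank<size (remove⁺ X Xw w≢v)))
      ... | no  _    = wu , Xu , ru<rw

      few-earlier : ∀ {w} → T (X w) → length (earlierIn X rank w) ≤ d
      few-earlier {w} Xw with w ≟ᶠ v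
      ... | yes refl = ≤-trans
        (length-filter-mono _ _ (λ (vu , Xu , _) → Equivalence.from T-∧ (Equivalence.from T-∧ (Xv , Xu) , vu)) (vertices G))
        degree≤d
      ... | no  w≢v  = ≤-trans
        (length-filter-mono _ _ (earlier-remains Xw w≢v) (vertices G))
        (R.few-earlier (remove⁺ X Xw w≢v))

    ranking : ∀ k X → size X ≤ k → Ranking X
    ranking k X size≤k with any? (T? ∘ X) (vertices G)
    ... | no none = emptyRanking (λ v Xv → none (lose (∈-allFin v) Xv))
    ranking zero    X size≤0   | yes some = contradiction size≤0 (<⇒≱ (filter-some (T? ∘ X) some))
    ranking (suc k) X size≤1+k | yes some with find some
    ... | v₀ , _ , Xv₀ with degenerate (induced X (v₀ , Xv₀))
    ... | v , Xv , degree≤d = rankLast Xv (subst (_≤ d) (sum-boolToℕ _ (vertices G)) degree≤d)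
                                (ranking k (remove X v) (≤-pred (<-≤-trans (remove-shrinks X Xv) size≤1+k)))

  degeneracyOrdering : DegeneracyOrdering d G
  degeneracyOrdering = record
    { rank           = rank
    ; rank<n         = λ v → <-≤-trans (rank<size _) size≤n
    ; rank-injective = rank-injective _ _
    ; few-earlier    = λ v → ≤-trans (length-filter-mono _ _ (λ (vw , lt) → vw , _ , lt) (vertices G)) (few-earlier _)
    }
    where
    size≤n : size (λ _ → true) ≤ n G
    size≤n = subst (size (λ _ → true) ≤_) (length-tabulate id) (length-filter (T? ∘ (λ _ → true)) (vertices G))
    open Ranking (ranking (n G) (λ _ → true) size≤n)

-- Incidences

module Incidences (G : Graph) where

  private
    V = Vertex G
    I = Incidence G

  inc-≡ : ∀ {i j : I} → vtx i ≡ vtx j → other i ≡ other j → i ≡ j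
  inc-≡ {inc a b p} {inc _ _ q} refl refl = cong (inc a b) (T-irrelevant p q)

  _≟ᴵ_ : DecidableEquality I
  i ≟ᴵ j = map′ (λ (e₁ , e₂) → inc-≡ e₁ e₂) (λ i≡j → cong vtx i≡j , cong other i≡j)
                (vtx i ≟ᶠ vtx j ×-dec other i ≟ᶠ other j)

  sameEdge? : (a b c e : V) → Dec (SameEdge a b c e)
  sameEdge? a b c e = (a ≟ᶠ c ×-dec b ≟ᶠ e) ⊎-dec (a ≟ᶠ e ×-dec b ≟ᶠ c)

  incAdj? : ∀ i j → Dec (IncAdj G i j)
  incAdj? (inc v u _) (inc w x _) =
    v ≟ᶠ w ⊎-dec sameEdge? v u w x ⊎-dec (T? (adj G v w) ×-dec (sameEdge? v w v u ⊎-dec sameEdge? v w w x))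

  adj-sym : ∀ {v w} → T (adj G v w) → T (adj G w v)
  adj-sym {v} {w} = subst T (Graph.sym G v w)

  incAdj-sym : Symmetric (IncAdj G)
  incAdj-sym {inc v u _} {inc w x _} = λ where
    (inj₁ v≡w)                                 → inj₁ (sym v≡w)
    (inj₂ (inj₁ (inj₁ (v≡w , u≡x))))           → inj₂ (inj₁ (inj₁ (sym v≡w , sym u≡x)))
    (inj₂ (inj₁ (inj₂ (v≡x , u≡w))))           → inj₂ (inj₁ (inj₂ (sym u≡w , sym v≡x)))
    (inj₂ (inj₂ (vw , inj₁ (inj₁ (_ , w≡u))))) → inj₂ (inj₂ (adj-sym vw , inj₂ (inj₂ (w≡u , refl))))
    (inj₂ (inj₂ (_  , inj₁ (inj₂ (_ , w≡v))))) → inj₁ w≡v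
    (inj₂ (inj₂ (_  , inj₂ (inj₁ (v≡w , _))))) → inj₁ (sym v≡w)
    (inj₂ (inj₂ (vw , inj₂ (inj₂ (v≡x , _))))) → inj₂ (inj₂ (adj-sym vw , inj₁ (inj₁ (refl , v≡x))))

  incAdj-cases : ∀ x y → IncAdj G x y → vtx y ≡ vtx x ⊎ vtx y ≡ other x ⊎ other y ≡ vtx x
  incAdj-cases (inc v u _) (inc w x _) = λ where
    (inj₁ v≡w)                                → inj₁ (sym v≡w)
    (inj₂ (inj₁ (inj₁ (v≡w , _))))            → inj₁ (sym v≡w)
    (inj₂ (inj₁ (inj₂ (_ , u≡w))))            → inj₂ (inj₁ (sym u≡w))
    (inj₂ (inj₂ (_ , inj₁ (inj₁ (_ , w≡u))))) → inj₂ (inj₁ w≡u)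
    (inj₂ (inj₂ (_ , inj₁ (inj₂ (_ , w≡v))))) → inj₁ w≡v
    (inj₂ (inj₂ (_ , inj₂ (inj₁ (v≡w , _))))) → inj₁ (sym v≡w)
    (inj₂ (inj₂ (_ , inj₂ (inj₂ (v≡x , _))))) → inj₂ (inj₂ (sym v≡x))

  incidencesFrom : V → List V → List I
  incidencesFrom a zs = mapWith∈ (filter (T? ∘ adj G a) zs) λ z∈ → inc a _ (proj₂ (∈-filter⁻ (T? ∘ adj G a) {xs = zs} z∈))

  incidencesInto : V → List V → List I
  incidencesInto a zs = mapWith∈ (filter (λ z → T? (adj G z a)) zs) λ z∈ → inc _ a (proj₂ (∈-filter⁻ (λ z → T? (adj G z a)) {xs = zs} z∈))

  ∈-incidencesFrom : ∀ {zs} (y : I) → other y ∈ zs → y ∈ incidencesFrom (vtx y) zs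
  ∈-incidencesFrom (inc a b p) b∈zs = mapWith∈⁺ _ (b , ∈-filter⁺ (T? ∘ adj G a) b∈zs p , inc-≡ refl refl)

  ∈-incidencesInto : ∀ {zs} (y : I) → vtx y ∈ zs → y ∈ incidencesInto (other y) zs
  ∈-incidencesInto (inc a b p) a∈zs = mapWith∈⁺ _ (a , ∈-filter⁺ (λ z → T? (adj G z b)) a∈zs p , inc-≡ refl refl)

  length-incidencesFrom : ∀ a zs → length (incidencesFrom a zs) ≤ length zs
  length-incidencesFrom a zs =
    subst (_≤ length zs) (sym (length-mapWith∈ (setoid V) (filter (T? ∘ adj G a) zs))) (length-filter (T? ∘ adj G a) zs)

  length-incidencesInto : ∀ a zs → length (incidencesInto a zs) ≤ length zs
  length-incidencesInto a zs =
    subst (_≤ length zs) (sym (length-mapWith∈ (setoid V) (filter (λ z → T? (adj G z a)) zs))) (length-filter (λ z → T? (adj G z a)) zs)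

  length-incidencesAt : ∀ a → length (incidencesFrom a (vertices G)) ≤ maxDegree G
  length-incidencesAt a = begin
    length (incidencesFrom a (vertices G))              ≡⟨ length-mapWith∈ (setoid V) (filter (T? ∘ adj G a) (vertices G)) ⟩
    length (filter (T? ∘ adj G a) (vertices G))         ≡⟨ sym (sum-boolToℕ (adj G a) (vertices G)) ⟩
    degree G a                                          ≤⟨ ≤-foldr-⊔ (∈-map⁺ (degree G) (∈-allFin a)) ⟩
    maxDegree G                                         ∎
    where open ≤-Reasoning

  allIncidences : List I
  allIncidences = concatMap (λ a → incidencesFrom a (vertices G)) (vertices G)

  ∈-allIncidences : ∀ i → i ∈ allIncidences
  ∈-allIncidences i = ∈-concatMap⁺ _ (lose (∈-allFin (vtx i)) (∈-incidencesFrom i (∈-allFin (other i))))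

  private
    N : ℕ
    N = length allIncidences

    enum : Fin N → I
    enum = lookup allIncidences

    idx : I → Fin N
    idx i = Any.index (∈-allIncidences i)

    enum-idx : ∀ i → enum (idx i) ≡ i
    enum-idx i = sym (lookup-index (∈-allIncidences i))

  ∀-dec : {P : I → Set} → Decidable P → Dec (∀ i → P i)
  ∀-dec P? = map′ (λ all i → All.lookup all (∈-allIncidences i)) (λ all → All.tabulate λ {i} _ → all i)
                  (all? P? allIncidences)

  Proper : (I → ℕ) → Set
  Proper σ = ∀ i j → i ≢ j → IncAdj G i j → σ i ≢ σ j

  proper? : ∀ σ → Dec (Proper σ)
  proper? σ = ∀-dec λ i → ∀-dec λ j → ¬? (i ≟ᴵ j) →-dec (incAdj? i j →-dec ¬? (σ i ≟ σ j))

  proper-resp : ∀ {σ τ} → (∀ i → σ i ≡ τ i) → Proper σ → Proper τ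
  proper-resp σ≗τ proper i j i≢j ij e = proper i j i≢j ij (trans (σ≗τ i) (trans e (sym (σ≗τ j))))

  listColourable-resp : ∀ {L L′} → (∀ i → L i ≡ L′ i) → ListIncColourable G L → ListIncColourable G L′
  listColourable-resp L≗L′ (σ , σ∈L , proper) = σ , (λ i → subst (σ i ∈_) (L≗L′ i) (σ∈L i)) , proper

  sized-resp : ∀ {p L L′} → (∀ i → L i ≡ L′ i) → ListAssignmentOfSize G p L → ListAssignmentOfSize G p L′
  sized-resp L≗L′ sized i = subst Unique (L≗L′ i) (proj₁ (sized i)) , trans (cong length (sym (L≗L′ i))) (proj₂ (sized i))

  sized? : ∀ p L → Dec (ListAssignmentOfSize G p L)
  sized? p L = ∀-dec λ i → unique? (L i) ×-dec length (L i) ≟ p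
    where open import Data.List.Relation.Unary.Unique.DecPropositional _≟_ using (unique?)

  listColourable? : ∀ L → Dec (ListIncColourable G L)
  listColourable? L = map′ fromVector toVector (any? (proper? ∘ colouring) (vectorsOver (L ∘ enum)))
    where
    colouring : Vec ℕ N → I → ℕ
    colouring v = Vec.lookup v ∘ idx

    fromVector : Any (Proper ∘ colouring) (vectorsOver (L ∘ enum)) → ListIncColourable G L
    fromVector found with find found
    ... | v , v∈ , proper =
      colouring v , (λ i → subst (λ j → colouring v i ∈ L j) (enum-idx i) (∈-vectorsOver⁻ v∈ (idx i))) , proper

    toVector : ListIncColourable G L → Any (Proper ∘ colouring) (vectorsOver (L ∘ enum))
    toVector (σ , σ∈L , proper) = lose
      (∈-vectorsOver⁺ v (λ k → subst (_∈ L (enum k)) (sym (lookup∘tabulate (σ ∘ enum) k)) (σ∈L (enum k))))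
      (proper-resp (λ i → sym (trans (lookup∘tabulate (σ ∘ enum) (idx i)) (cong σ (enum-idx i)))) proper)
      where
      v : Vec ℕ N
      v = Vec.tabulate (σ ∘ enum)

  colourable⇔ : ∀ p → IncColourable G p ⇔ ListIncColourable G (λ _ → upTo p)
  colourable⇔ p = mk⇔
    (λ (σ , proper) → toℕ ∘ σ , (λ i → ∈-upTo⁺ (toℕ<n (σ i))) , λ i j i≢j ij → proper i j i≢j ij ∘ toℕ-injective)
    (λ (σ , σ<p , proper) → (λ i → fromℕ< (∈-upTo⁻ (σ<p i))) , λ i j i≢j ij e →
      proper i j i≢j ij (trans (sym (toℕ-fromℕ< _)) (trans (cong toℕ e) (toℕ-fromℕ< _))))

  choosable⇒colourable : ∀ {p} → IncChoosable G p → IncColourable G p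
  choosable⇒colourable {p} choosable =
    Equivalence.from (colourable⇔ p) (choosable (λ _ → upTo p) (λ _ → upTo⁺ p , length-upTo p))

  colourable? : ∀ p → Dec (IncColourable G p)
  colourable? p = map′ (Equivalence.from (colourable⇔ p)) (Equivalence.to (colourable⇔ p)) (listColourable? (λ _ → upTo p))

  -- Only the equalities between colours matter, so every list assignment may be replaced by
  -- the positions of its colours in the concatenation of all its lists.
  module _ (L : I → List ℕ) where

    open Relabelling _≟_ (concatMap L allIncidences)

    relabelled : I → List ℕ
    relabelled = map position ∘ L

    private
      ∈-all : ∀ {i c} → c ∈ L i → c ∈ concatMap L allIncidences
      ∈-all {i} c∈ = ∈-concatMap⁺ L (lose (∈-allIncidences i) c∈)

    relabelled-sized : ∀ {p} → ListAssignmentOfSize G p L → ListAssignmentOfSize G p relabelled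
    relabelled-sized sized i =
      Unique-map⁺ (λ c∈ c′∈ → position-injective (∈-all c∈) (∈-all c′∈)) (proj₁ (sized i)) ,
      trans (length-map position (L i)) (proj₂ (sized i))

    relabelled-bounded : ∀ {p} → ListAssignmentOfSize G p L → ∀ i {c} → c ∈ relabelled i → c ∈ upTo (N * p)
    relabelled-bounded sized i c∈ with ∈-map⁻ position c∈
    ... | c′ , c′∈ , refl = ∈-upTo⁺ (<-≤-trans (position< (∈-all c′∈))
                                        (≤-reflexive (length-concatMap-const L (proj₂ ∘ sized) allIncidences)))

    colourable-relabelled : ListIncColourable G relabelled → ListIncColourable G L
    colourable-relabelled (σ , σ∈ , proper) = (λ i → proj₁ (preimage i)) , (λ i → proj₁ (proj₂ (preimage i))) , proper′
      where
      preimage : ∀ i → ∃ λ c → c ∈ L i × σ i ≡ position c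
      preimage i = ∈-map⁻ position (σ∈ i)

      proper′ : Proper (λ i → proj₁ (preimage i))
      proper′ i j i≢j ij e = proper i j i≢j ij
        (trans (proj₂ (proj₂ (preimage i))) (trans (cong position e) (sym (proj₂ (proj₂ (preimage j))))))

  choosable? : ∀ p → Dec (IncChoosable G p)
  choosable? p = map′ sufficient necessary (all? testable candidates)
    where
    candidates : List (Vec (List ℕ) N)
    candidates = vectorsOver (λ _ → listsOfLength p (upTo (N * p)))

    assignment : Vec (List ℕ) N → I → List ℕ
    assignment v = Vec.lookup v ∘ idx

    Testable : Vec (List ℕ) N → Set
    Testable v = ListAssignmentOfSize G p (assignment v) → ListIncColourable G (assignment v)

    testable : ∀ v → Dec (Testable v)
    testable v = sized? p (assignment v) →-dec listColourable? (assignment v)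

    necessary : IncChoosable G p → All Testable candidates
    necessary choosable = All.tabulate λ {v} _ → choosable (assignment v)

    sufficient : All Testable candidates → IncChoosable G p
    sufficient tested L sized = colourable-relabelled L
      (listColourable-resp assignment≡ (All.lookup tested v∈ (sized-resp (sym ∘ assignment≡) (relabelled-sized L sized))))
      where
      v : Vec (List ℕ) N
      v = Vec.tabulate (relabelled L ∘ enum)

      assignment≡ : ∀ i → assignment v i ≡ relabelled L i
      assignment≡ i = trans (lookup∘tabulate (relabelled L ∘ enum) (idx i)) (cong (relabelled L) (enum-idx i))

      candidate : ∀ i → relabelled L i ∈ listsOfLength p (upTo (N * p))
      candidate i = subst (λ q → relabelled L i ∈ listsOfLength q (upTo (N * p)))
        (proj₂ (relabelled-sized L sized i)) (∈-listsOfLength (relabelled L i) (relabelled-bounded L sized i))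

      v∈ : v ∈ candidates
      v∈ = ∈-vectorsOver⁺ v λ k →
        subst (_∈ listsOfLength p (upTo (N * p))) (sym (lookup∘tabulate (relabelled L ∘ enum) k)) (candidate (enum k))

-- Ordering the incidences

count-bound : ∀ {D d l₁ l₂ l₃} → l₁ ≤ D → l₂ ≤ d → suc l₃ ≤ d → l₁ + (l₂ + l₃) ≤ D + 2 * d ∸ 1
count-bound {D} {d} {l₁} {l₂} {l₃} l₁≤D l₂≤d l₃<d = ∸-monoˡ-≤ 1 (begin
  suc (l₁ + (l₂ + l₃))  ≡⟨ sym (trans (cong (l₁ +_) (+-suc l₂ l₃)) (+-suc l₁ (l₂ + l₃))) ⟩
  l₁ + (l₂ + suc l₃)    ≤⟨ +-mono-≤ l₁≤D (+-mono-≤ l₂≤d l₃<d) ⟩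
  D + (d + d)           ≡⟨ cong (λ m → D + (d + m)) (sym (+-identityʳ d)) ⟩
  D + 2 * d             ∎)
  where open ≤-Reasoning

lex-contradiction : ∀ {q q′ t t′} → q′ < q → ¬ (q < q′ ⊎ (q ≡ q′ × t ≤ t′))
lex-contradiction q′<q (inj₁ q<q′)      = <-asym q<q′ q′<q
lex-contradiction q′<q (inj₂ (refl , _)) = <-irrefl refl q′<q

module IncidenceOrder {d : ℕ} {G : Graph} (ordering : DegeneracyOrdering d G) where

  open DegeneracyOrdering ordering
  open Incidences G

  private
    V = Vertex G
    I = Incidence G

  triple : I → ℕ × ℕ × ℕ
  triple (inc a b _) = if rank a <ᵇ rank b then (rank a , 0 , rank b) else (rank b , 1 , rank a)

  Bounded : ℕ × ℕ × ℕ → Set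
  Bounded (q , t , s) = q < n G × t < 2 × s < n G

  encode : ℕ × ℕ × ℕ → ℕ
  encode (q , t , s) = pair (n G) (pair 2 q t) s

  key : I → ℕ
  key = encode ∘ triple

  triple-lower : ∀ i → rank (vtx i) < rank (other i) → triple i ≡ (rank (vtx i) , 0 , rank (other i))
  triple-lower (inc a b _) ra<rb with rank a <ᵇ rank b | <ᵇ-reflects-< (rank a) (rank b)
  ... | true  | _         = refl
  ... | false | ofⁿ ra≮rb = contradiction ra<rb ra≮rb

  triple-upper : ∀ i → rank (other i) < rank (vtx i) → triple i ≡ (rank (other i) , 1 , rank (vtx i))
  triple-upper (inc a b _) rb<ra with rank a <ᵇ rank b | <ᵇ-reflects-< (rank a) (rank b)
  ... | true  | ofʸ ra<rb = contradiction ra<rb (<-asym rb<ra)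
  ... | false | _         = refl

  orientation : ∀ (i : I) → rank (vtx i) < rank (other i) ⊎ rank (other i) < rank (vtx i)
  orientation (inc a b p) with <-cmp (rank a) (rank b)
  ... | tri< ra<rb _ _ = inj₁ ra<rb
  ... | tri≈ _ ra≡rb _ = ⊥-elim (subst T (irrefl G a) (subst (T ∘ adj G a) (sym (rank-injective ra≡rb)) p))
  ... | tri> _ _ rb<ra = inj₂ rb<ra

  triple-bounded : ∀ i → Bounded (triple i)
  triple-bounded i@(inc a b _) with orientation i
  ... | inj₁ ra<rb = subst Bounded (sym (triple-lower i ra<rb)) (rank<n a , z<s , rank<n b)
  ... | inj₂ rb<ra = subst Bounded (sym (triple-upper i rb<ra)) (rank<n b , s<s z<s , rank<n a)

  triple-injective : ∀ x y → triple x ≡ triple y → x ≡ y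
  triple-injective x y eq with orientation x | orientation y
  ... | inj₁ ra<rb | inj₁ rc<re
    with e ← subst₂ _≡_ (triple-lower x ra<rb) (triple-lower y rc<re) eq
    = inc-≡ (rank-injective (cong proj₁ e)) (rank-injective (cong (proj₂ ∘ proj₂) e))
  ... | inj₁ ra<rb | inj₂ re<rc
    = contradiction (cong (proj₁ ∘ proj₂) (subst₂ _≡_ (triple-lower x ra<rb) (triple-upper y re<rc) eq)) λ ()
  ... | inj₂ rb<ra | inj₁ rc<re
    = contradiction (cong (proj₁ ∘ proj₂) (subst₂ _≡_ (triple-upper x rb<ra) (triple-lower y rc<re) eq)) λ ()
  ... | inj₂ rb<ra | inj₂ re<rc
    with e ← subst₂ _≡_ (triple-upper x rb<ra) (triple-upper y re<rc) eq
    = inc-≡ (rank-injective (cong (proj₂ ∘ proj₂) e)) (rank-injective (cong proj₁ e))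

  encode-<⇒ : ∀ {q t s q′ t′ s′} → Bounded (q′ , t′ , s′) → encode (q , t , s) < encode (q′ , t′ , s′) →
              q < q′ ⊎ (q ≡ q′ × t ≤ t′)
  encode-<⇒ (_ , t′<2 , s′<n) lt with pair-≤⇒lex s′<n (<⇒≤ lt)
  ... | inj₁ major<       = pair-≤⇒lex t′<2 (<⇒≤ major<)
  ... | inj₂ (major≡ , _) = pair-≤⇒lex t′<2 (≤-reflexive major≡)

  encode-injective : ∀ {u u′} → Bounded u → Bounded u′ → encode u ≡ encode u′ → u ≡ u′
  encode-injective {q , t , s} {q′ , t′ , s′} (_ , t<2 , s<n) (_ , t′<2 , s′<n) eq
    with major≡ , refl ← pair-injective s<n s′<n eq
    with refl , refl ← pair-injective {c = q} {c′ = q′} t<2 t′<2 major≡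
    = refl

  encode<bound : ∀ {u} → Bounded u → encode u < encode (n G , 0 , 0)
  encode<bound (q<n , t<2 , s<n) = pair-mono-< s<n (pair-mono-< t<2 q<n)

  key-injective : ∀ {x y} → key x ≡ key y → x ≡ y
  key-injective {x} {y} = triple-injective x y ∘ encode-injective (triple-bounded x) (triple-bounded y)

  key<bound : ∀ i → key i < encode (n G , 0 , 0)
  key<bound = encode<bound ∘ triple-bounded

  before-lower : ∀ x y {q t s} → rank (vtx x) < rank (other x) → triple y ≡ (q , t , s) → key y < key x →
                 q < rank (vtx x) ⊎ (q ≡ rank (vtx x) × t ≤ 0)
  before-lower x y ra<rb ty lt = encode-<⇒ (subst Bounded (triple-lower x ra<rb) (triple-bounded x))
                                             (subst₂ _<_ (cong encode ty) (cong encode (triple-lower x ra<rb)) lt)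

  before-upper : ∀ x y {q t s} → rank (other x) < rank (vtx x) → triple y ≡ (q , t , s) → key y < key x →
                 q < rank (other x) ⊎ (q ≡ rank (other x) × t ≤ 1)
  before-upper x y rb<ra ty lt = encode-<⇒ (subst Bounded (triple-upper x rb<ra) (triple-bounded x))
                                             (subst₂ _<_ (cong encode ty) (cong encode (triple-upper x rb<ra)) lt)

  private
    earlier : V → List V
    earlier = earlierNeighbours G rank

    earlierBelow : V → ℕ → List V
    earlierBelow v r = filter (λ w → rank w <? r) (earlier v)

    ∈-earlier : ∀ {v w} → T (adj G v w) → rank w < rank v → w ∈ earlier v
    ∈-earlier {w = w} vw rw<rv = ∈-filter⁺ _ (∈-allFin w) (vw , rw<rv)

    ∈-earlierBelow : ∀ {v w r} → T (adj G v w) → rank w < rank v → rank w < r → w ∈ earlierBelow v r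
    ∈-earlierBelow vw rw<rv rw<r = ∈-filter⁺ _ (∈-earlier vw rw<rv) rw<r

    few-below : ∀ {u v} → u ∈ earlier v → suc (length (earlierBelow v (rank u))) ≤ d
    few-below {u} {v} u∈ = ≤-trans (filter-notAll _ (earlier v) (lose u∈ (<-irrefl refl))) (few-earlier v)

  K : ℕ
  K = maxDegree G + 2 * d ∸ 1

  open GreedyListColouring (IncAdj G) (λ {i} {j} → incAdj-sym {i} {j}) key key-injective (encode (n G , 0 , 0)) key<bound K

  coverLower : ∀ x → rank (vtx x) < rank (other x) → EarlierCover x
  coverLower x@(inc a b p) ra<rb = record
    { members  = atA ++ (intoA ++ fromB)
    ; length≤K = subst (_≤ K) (sym (trans (length-++ atA) (cong (length atA +_) (length-++ intoA))))
                   (count-bound (length-incidencesAt a)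
                                (≤-trans (length-incidencesInto a (earlier a)) (few-earlier a))
                                (≤-trans (s≤s (length-incidencesFrom b (earlierBelow b (rank a)))) (few-below (∈-earlier (adj-sym p) ra<rb))))
    ; self     = ∈-++⁺ˡ (∈-incidencesFrom x (∈-allFin b))
    ; earlier  = covers
    }
    where
    atA intoA fromB : List I
    atA   = incidencesFrom a (vertices G)
    intoA = incidencesInto a (earlier a)
    fromB = incidencesFrom b (earlierBelow b (rank a))

    covers : ∀ y → key y < key x → IncAdj G x y → y ∈ atA ++ (intoA ++ fromB)
    covers y@(inc c e q) lt xy with incAdj-cases x y xy
    ... | inj₁ refl = ∈-++⁺ˡ (∈-incidencesFrom y (∈-allFin e))
    ... | inj₂ (inj₁ refl) with orientation y
    ...   | inj₁ rb<re = contradiction (before-lower x y ra<rb (triple-lower y rb<re) lt) (lex-contradiction ra<rb)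
    ...   | inj₂ re<rb with before-lower x y ra<rb (triple-upper y re<rb) lt
    ...     | inj₁ re<ra = ∈-++⁺ʳ atA (∈-++⁺ʳ intoA (∈-incidencesFrom y (∈-earlierBelow q re<rb re<ra)))
    covers y@(inc c e q) lt xy | inj₂ (inj₂ refl) with orientation y
    ...   | inj₁ rc<ra = ∈-++⁺ʳ atA (∈-++⁺ˡ (∈-incidencesInto y (∈-earlier (adj-sym q) rc<ra)))
    ...   | inj₂ ra<rc with before-lower x y ra<rb (triple-upper y ra<rc) lt
    ...     | inj₁ ra<ra = contradiction ra<ra (<-irrefl refl)

  coverUpper : ∀ x → rank (other x) < rank (vtx x) → EarlierCover x
  coverUpper x@(inc a b p) rb<ra = record
    { members  = atB ++ (x ∷ fromA ++ intoA)
    ; length≤K = subst (_≤ K) (sym (trans (length-++ atB) (cong (length atB +_) (length-++ (x ∷ fromA)))))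
                   (count-bound (length-incidencesAt b)
                                (≤-trans (s≤s (length-incidencesFrom a below)) few)
                                (≤-trans (s≤s (length-incidencesInto a below)) few))
    ; self     = ∈-++⁺ʳ atB (here refl)
    ; earlier  = covers
    }
    where
    below : List V
    below = earlierBelow a (rank b)

    atB fromA intoA : List I
    atB   = incidencesFrom b (vertices G)
    fromA = incidencesFrom a below
    intoA = incidencesInto a below

    few : suc (length below) ≤ d
    few = few-below (∈-earlier p rb<ra)

    covers : ∀ y → key y < key x → IncAdj G x y → y ∈ atB ++ (x ∷ fromA ++ intoA)
    covers y@(inc c e q) lt xy with incAdj-cases x y xy
    ... | inj₂ (inj₁ refl) = ∈-++⁺ˡ (∈-incidencesFrom y (∈-allFin e))
    ... | inj₁ refl with orientation y
    ...   | inj₁ ra<re = contradiction (before-upper x y rb<ra (triple-lower y ra<re) lt) (lex-contradiction rb<ra)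
    ...   | inj₂ re<ra with before-upper x y rb<ra (triple-upper y re<ra) lt
    ...     | inj₁ re<rb       = ∈-++⁺ʳ atB (there (∈-++⁺ˡ (∈-incidencesFrom y (∈-earlierBelow q re<ra re<rb))))
    ...     | inj₂ (re≡rb , _) = ∈-++⁺ʳ atB (here (inc-≡ refl (rank-injective re≡rb)))
    covers y@(inc c e q) lt xy | inj₂ (inj₂ refl) with orientation y
    ...   | inj₂ ra<rc = contradiction (before-upper x y rb<ra (triple-upper y ra<rc) lt) (lex-contradiction rb<ra)
    ...   | inj₁ rc<ra with before-upper x y rb<ra (triple-lower y rc<ra) lt
    ...     | inj₁ rc<rb       = ∈-++⁺ʳ atB (there (∈-++⁺ʳ fromA (∈-incidencesInto y (∈-earlierBelow (adj-sym q) rc<ra rc<rb))))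
    ...     | inj₂ (rc≡rb , _) = ∈-++⁺ˡ (subst (λ v → y ∈ incidencesFrom v (vertices G)) (rank-injective rc≡rb)
                                          (∈-incidencesFrom y (∈-allFin a)))

  cover : ∀ x → EarlierCover x
  cover x = [ coverLower x , coverUpper x ]′ (orientation x)

  choosable : IncChoosable G K
  choosable L sized = listColouring cover L (proj₁ ∘ sized) (proj₂ ∘ sized)

theorem6 : (d : ℕ) (G : Graph) → Degenerated d G →
    Σ ℕ λ χ → Σ ℕ λ ch →
      IsIncChromatic G χ × IsIncChoice G ch × χ ≤ ch × ch ≤ maxDegree G + 2 * d ∸ 1
theorem6 d G degenerate =
  let open Incidences G
      open IncidenceOrder (degeneracyOrdering degenerate)
      (ch , ch-choosable , ch-least) = minimal choosable? choosable
      (χ , χ-colourable , χ-least)   = minimal colourable? (choosable⇒colourable ch-choosable)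
  in χ , ch , (χ-colourable , χ-least) , (ch-choosable , ch-least) ,
     ≮⇒≥ (λ ch<χ → χ-least ch ch<χ (choosable⇒colourable ch-choosable)) ,
     ≮⇒≥ (λ K<ch → ch-least K K<ch choosable)
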